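{- For every monotonic-MAX GNN $\mathcal{N}$ and all pointed graphs $(G,v)$, $(G',v')$ of its dimension, if there is a homomorphism from $(G,v)$ to $(G',v')$ and $\mathcal{N}(G,v)=\mathsf{true}$, then $\mathcal{N}(G',v')=\mathsf{true}$.
   Context: Graphs are finite, undirected, simple, node-labelled $G=(V,E,\lambda)$ with $\lambda:V\to\{0,1\}^d$; a pointed graph is $(G,v)$. A homomorphism from $(G,v)$ to $(G',v')$, $G'=(V',E',\lambda')$, is $h:V\to V'$ with $h(v)=v'$ such that $\{u,w\}\in E$ implies $\{h(u),h(w)\}\in E'$ and every entry equal to $1$ in $\lambda(u)$ is $1$ in $\lambda'(h(u))$. A GNN of dimension $d$ with $L$ layers consists of layers $(\mathsf{agg}_\ell,\mathsf{comb}_\ell)$ ($\mathsf{agg}_\ell$ maps finite multisets of vectors to vectors, $\mathsf{comb}_\ell$ maps vectors to vectors, dimensions compatible, first input dimension $d$) and a classification function $\mathsf{cls}$ from vectors to $\{\mathsf{false},\mathsf{true}\}$. On $G$: $\lambda^{(0)}=\lambda$, $\lambda^{(\ell)}(v)=\mathsf{comb}_\ell(\lambda^{(\ell-1)}(v),\mathsf{agg}_\ell(\{\!\{\lambda^{(\ell-1)}(w):\{v,w\}\in E\}\!\}))$, $\mathcal{N}(G,v)=\mathsf{cls}(\lambda^{(L)}(v))$. Order: vectors componentwise; multisets $M\le M'$ iff there is an injection $f:M\to M'$ with $\mathbf{x}\le f(\mathbf{x})$; $\mathsf{false}\le\mathsf{true}$. A GNN is monotonic if all its aggregation, combination and classification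 functions are non-decreasing. A monotonic-MAX GNN is a monotonic GNN all of whose aggregation functions are MAX (componentwise maximum of the multiset). -}

module Defs where

open import Level using (Level; _⊔_)
open import Data.Nat using (ℕ)
open import Data.Bool using (Bool; true; false; if_then_else_)
open import Data.Fin using (Fin)
open import Data.Vec using (Vec; lookup; map; zipWith; replicate; allFin; foldr)
open import Data.Product using (Σ; _×_; _,_)
open import Relation.Binary.PropositionalEquality using (_≡_)
open import Relation.Nullary using (¬_)
open import Relation.Binary.Lattice.Bundles using (BoundedJoinSemilattice)

record Graph (d : ℕ) : Set where
  field
    n      : ℕ
    adj    : Fin n → Fin n → Bool
    sym    : ∀ u w → adj u w ≡ adj w u
    irrefl : ∀ u → adj u u ≡ false
    label  : Fin n → Vec Bool d

PointedGraph : ℕ → Set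
PointedGraph d = Σ (Graph d) (λ G → Fin (Graph.n G))

record Hom {d : ℕ} (P P' : PointedGraph d) : Set where
  private
    G  = Data.Product.proj₁ P
    v  = Data.Product.proj₂ P
    G' = Data.Product.proj₁ P'
    v' = Data.Product.proj₂ P'
  field
    h       : Fin (Graph.n G) → Fin (Graph.n G')
    point   : h v ≡ v'
    edges   : ∀ u w → Graph.adj G u w ≡ true → Graph.adj G' (h u) (h w) ≡ true
    labels  : ∀ u (k : Fin d) → lookup (Graph.label G u) k ≡ true
                              → lookup (Graph.label G' (h u)) k ≡ true

-- GNNs over an abstract value domain L (a bounded join-semilattice:
-- componentwise order, componentwise maximum _∨_, and ⊥ = MAX of the
-- empty multiset).  Bits 0/1 of input labels are embedded as 𝟘/𝟙.

module GNNs {c ℓ₁ ℓ₂ : Level} (L : BoundedJoinSemilattice c ℓ₁ ℓ₂)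
            (𝟘 𝟙 : BoundedJoinSemilattice.Carrier L) where

  open BoundedJoinSemilattice L

  _≤v_ : ∀ {m} → Vec Carrier m → Vec Carrier m → Set ℓ₂
  x ≤v y = ∀ k → lookup x k ≤ lookup y k

  _∨v_ : ∀ {m} → Vec Carrier m → Vec Carrier m → Vec Carrier m
  _∨v_ = zipWith _∨_

  ⊥v : ∀ {m} → Vec Carrier m
  ⊥v = replicate _ ⊥

  record Layer (din dout : ℕ) : Set (c ⊔ ℓ₂) where
    field
      comb      : Vec Carrier din → Vec Carrier din → Vec Carrier dout
      comb-mono : ∀ {x x' a a'} → x ≤v x' → a ≤v a' → comb x a ≤v comb x' a'

  data Layers : ℕ → ℕ → Set (c ⊔ ℓ₂) where
    []  : ∀ {d} → Layers d d
    _∷_ : ∀ {d e f} → Layer d e → Layers e f → Layers d f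

  record MonMaxGNN (d : ℕ) : Set (c ⊔ ℓ₂) where
    field
      dout     : ℕ
      layers   : Layers d dout
      cls      : Vec Carrier dout → Bool
      cls-mono : ∀ {x y} → x ≤v y → cls x ≡ true → cls y ≡ true

  bit : Bool → Carrier
  bit false = 𝟘
  bit true  = 𝟙

  maxNbr : ∀ {n m} → (Fin n → Fin n → Bool) → (Fin n → Vec Carrier m)
         → Fin n → Vec Carrier m
  maxNbr adj f v = foldr _ (λ w acc → if adj v w then (f w ∨v acc) else acc) ⊥v (allFin _)

  runLayers : ∀ {n d e} → (Fin n → Fin n → Bool) → Layers d e
            → (Fin n → Vec Carrier d) → (Fin n → Vec Carrier e)
  runLayers adj []       f = f
  runLayers adj (l ∷ ls) f =
    runLayers adj ls (λ v → Layer.comb l (f v) (maxNbr adj f v))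

  eval : ∀ {d} → MonMaxGNN d → PointedGraph d → Bool
  eval N (G , v) =
    MonMaxGNN.cls N
      (runLayers (Graph.adj G) (MonMaxGNN.layers N) (λ u → map bit (Graph.label G u)) v)

{-# OPTIONS --safe #-}
module Submission where

open import Defs
open import Level using (Level)
open import Data.Nat using (ℕ)
open import Data.Bool using (Bool; true; false; if_then_else_)
open import Data.Fin using (Fin)
open import Data.Vec using (Vec; []; _∷_; lookup; map; allFin; foldr)
open import Data.Vec.Properties using (lookup-zipWith; lookup-replicate; lookup-map)
open import Data.Vec.Relation.Unary.Any using (here; there)
open import Data.Vec.Membership.Propositional using (_∈_)
open import Data.Vec.Membership.Propositional.Properties using (∈-allFin⁺)
open import Data.Product using (_,_)
open import Relation.Binary.Bundles using (Preorder)
open import Relation.Binary.Lattice.Bundles using (BoundedJoinSemilattice)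
open import Relation.Binary.PropositionalEquality
  using (_≡_; refl; subst; subst₂; sym; isEquivalence)
import Relation.Binary.Reasoning.Preorder as PreorderReasoning

-- A homomorphism h maps every neighbour w of u to a neighbour h w of h u, so
-- the MAX over the neighbours of u is bounded by the MAX over those of h u.
-- Combination functions are monotone, so by induction on the layers every
-- feature vector of u is bounded by that of h u; at the input this is label
-- preservation together with 𝟘 ≤ 𝟙, and at the output the classifier is monotone.

EdgePreserving : ∀ {n n'} → (Fin n → Fin n → Bool) → (Fin n' → Fin n' → Bool)
               → (Fin n → Fin n') → Set
EdgePreserving adj adj' h = ∀ u w → adj u w ≡ true → adj' (h u) (h w) ≡ true

module Monotonicity {c ℓ₁ ℓ₂ : Level} (L : BoundedJoinSemilattice c ℓ₁ ℓ₂)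
                    (𝟘 𝟙 : BoundedJoinSemilattice.Carrier L) where

  open BoundedJoinSemilattice L
    using (Carrier; _≤_; _∨_; ⊥; x≤x∨y; y≤x∨y; ∨-least; minimum)
    renaming (refl to ≤-refl; trans to ≤-trans)
  open GNNs L 𝟘 𝟙

  ≤v-preorder : ℕ → Preorder c c ℓ₂
  ≤v-preorder m = record
    { Carrier    = Vec Carrier m
    ; _≈_        = _≡_
    ; _≲_        = _≤v_
    ; isPreorder = record
      { isEquivalence = isEquivalence
      ; reflexive     = λ { refl k → ≤-refl }
      ; trans         = λ x≤y y≤z k → ≤-trans (x≤y k) (y≤z k)
      }
    }

  module ≤v-Reasoning {m : ℕ} = PreorderReasoning (≤v-preorder m)

  x≤vx∨vy : ∀ {m} (x y : Vec Carrier m) → x ≤v (x ∨v y)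
  x≤vx∨vy x y k = subst (lookup x k ≤_) (sym (lookup-zipWith _∨_ k x y)) (x≤x∨y _ _)

  y≤vx∨vy : ∀ {m} (x y : Vec Carrier m) → y ≤v (x ∨v y)
  y≤vx∨vy x y k = subst (lookup y k ≤_) (sym (lookup-zipWith _∨_ k x y)) (y≤x∨y _ _)

  ∨v-least : ∀ {m} (x y z : Vec Carrier m) → x ≤v z → y ≤v z → (x ∨v y) ≤v z
  ∨v-least x y z x≤z y≤z k =
    subst (_≤ lookup z k) (sym (lookup-zipWith _∨_ k x y)) (∨-least (x≤z k) (y≤z k))

  ⊥v-minimum : ∀ {m} (z : Vec Carrier m) → ⊥v ≤v z
  ⊥v-minimum z k = subst (_≤ lookup z k) (sym (lookup-replicate k ⊥)) (minimum _)

  module _ {n m : ℕ} (adj : Fin n → Fin n → Bool) (f : Fin n → Vec Carrier m) (v : Fin n)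
    where

    -- maxNbr adj f v unfolds to maxNbrIn (allFin _).
    maxNbrIn : ∀ {l} → Vec (Fin n) l → Vec Carrier m
    maxNbrIn = foldr _ (λ w acc → if adj v w then (f w ∨v acc) else acc) ⊥v

    maxNbrIn-upperBound : ∀ {l w} {xs : Vec (Fin n) l} →
                          w ∈ xs → adj v w ≡ true → f w ≤v maxNbrIn xs
    maxNbrIn-upperBound {xs = x ∷ xs} (here refl) vw rewrite vw = x≤vx∨vy (f x) (maxNbrIn xs)
    maxNbrIn-upperBound {w = w} {x ∷ xs} (there w∈xs) vw with adj v x
    ... | false = maxNbrIn-upperBound w∈xs vw
    ... | true  = begin
      f w                  ≲⟨ maxNbrIn-upperBound w∈xs vw ⟩
      maxNbrIn xs          ≲⟨ y≤vx∨vy (f x) (maxNbrIn xs) ⟩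
      f x ∨v maxNbrIn xs   ∎
      where open ≤v-Reasoning

    maxNbrIn-least : ∀ {l} (xs : Vec (Fin n) l) (b : Vec Carrier m) →
                     (∀ w → adj v w ≡ true → f w ≤v b) → maxNbrIn xs ≤v b
    maxNbrIn-least []       b nbr≤b = ⊥v-minimum b
    maxNbrIn-least (x ∷ xs) b nbr≤b with adj v x in vx
    ... | true  = ∨v-least (f x) (maxNbrIn xs) b (nbr≤b x vx) (maxNbrIn-least xs b nbr≤b)
    ... | false = maxNbrIn-least xs b nbr≤b

  module _ {n n' : ℕ} {adj : Fin n → Fin n → Bool} {adj' : Fin n' → Fin n' → Bool}
           {h : Fin n → Fin n'} (edges : EdgePreserving adj adj' h) where

    maxNbr-mono-hom : ∀ {m} (f : Fin n → Vec Carrier m) (f' : Fin n' → Vec Carrier m) →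
                      (∀ u → f u ≤v f' (h u)) →
                      ∀ v → maxNbr adj f v ≤v maxNbr adj' f' (h v)
    maxNbr-mono-hom f f' f≤f'∘h v =
      maxNbrIn-least adj f v (allFin _) (maxNbr adj' f' (h v)) nbr≤maxNbr'
      where
      open ≤v-Reasoning
      nbr≤maxNbr' : ∀ w → adj v w ≡ true → f w ≤v maxNbr adj' f' (h v)
      nbr≤maxNbr' w vw = begin
        f w                   ≲⟨ f≤f'∘h w ⟩
        f' (h w)              ≲⟨ maxNbrIn-upperBound adj' f' (h v) (∈-allFin⁺ (h w))
                                                     (edges v w vw) ⟩
        maxNbr adj' f' (h v)  ∎

    runLayers-mono-hom : ∀ {a b} (ls : Layers a b)
                         (f : Fin n → Vec Carrier a) (f' : Fin n' → Vec Carrier a) →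
                         (∀ u → f u ≤v f' (h u)) →
                         ∀ u → runLayers adj ls f u ≤v runLayers adj' ls f' (h u)
    runLayers-mono-hom []       f f' f≤f'∘h = f≤f'∘h
    runLayers-mono-hom (l ∷ ls) f f' f≤f'∘h =
      runLayers-mono-hom ls (λ u → comb (f u) (maxNbr adj f u))
                            (λ u → comb (f' u) (maxNbr adj' f' u))
        λ u → comb-mono (f≤f'∘h u) (maxNbr-mono-hom f f' f≤f'∘h u)
      where open Layer l

  bit-mono : 𝟘 ≤ 𝟙 → ∀ {b b'} → (b ≡ true → b' ≡ true) → bit b ≤ bit b'
  bit-mono 𝟘≤𝟙 {false} {false} _    = ≤-refl
  bit-mono 𝟘≤𝟙 {false} {true}  _    = 𝟘≤𝟙
  bit-mono 𝟘≤𝟙 {true}  {true}  _    = ≤-refl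
  bit-mono 𝟘≤𝟙 {true}  {false} b⇒b' with () ← b⇒b' refl

  map-bit-mono : 𝟘 ≤ 𝟙 → ∀ {m} (bs bs' : Vec Bool m) →
                 (∀ k → lookup bs k ≡ true → lookup bs' k ≡ true) →
                 map bit bs ≤v map bit bs'
  map-bit-mono 𝟘≤𝟙 bs bs' bs⇒bs' k =
    subst₂ _≤_ (sym (lookup-map k bit bs)) (sym (lookup-map k bit bs'))
               (bit-mono 𝟘≤𝟙 (bs⇒bs' k))

theorem5p4 : ∀ {c ℓ₁ ℓ₂} (L : BoundedJoinSemilattice c ℓ₁ ℓ₂)
    (𝟘 𝟙 : BoundedJoinSemilattice.Carrier L) → BoundedJoinSemilattice._≤_ L 𝟘 𝟙 →
    ∀ {d : ℕ} (N : GNNs.MonMaxGNN L 𝟘 𝟙 d) (P P' : PointedGraph d) →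
    Hom P P' → GNNs.eval L 𝟘 𝟙 N P ≡ true → GNNs.eval L 𝟘 𝟙 N P' ≡ true
theorem5p4 L 𝟘 𝟙 𝟘≤𝟙 {d} N (G , v) (G' , v') hom accepts =
  subst (λ u → cls (output G' u) ≡ true) point (cls-mono (output-mono v) accepts)
  where
  open BoundedJoinSemilattice L using (Carrier)
  open Monotonicity L 𝟘 𝟙
  open GNNs L 𝟘 𝟙
  open MonMaxGNN N
  open Hom hom

  input : (H : Graph d) → Fin (Graph.n H) → Vec Carrier d
  input H u = map bit (Graph.label H u)

  output : (H : Graph d) → Fin (Graph.n H) → Vec Carrier dout
  output H = runLayers (Graph.adj H) layers (input H)

  output-mono : ∀ u → output G u ≤v output G' (h u)
  output-mono = runLayers-mono-hom edges layers (input G) (input G')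
    λ u → map-bit-mono 𝟘≤𝟙 (Graph.label G u) (Graph.label G' (h u)) (labels u)
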